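{- Let $G$ be a finite group and $X$ a finite $G$-set with $|X|=v$. Let $D\subseteq X$ with $|D|=k$, and let $D'=X\setminus D$, $k'=|D'|=v-k$. Let $w$ be a nonnegative integer. Then the following are equivalent: (i) $|\alpha D\cap D'|=w$ (equivalently, $|D\cap \alpha D'|=w$) for all $\alpha\in G\setminus\{1_G\}$; (ii) $D$ is a $G$--$(v,k,k-w)$ difference set of $X$; (iii) $D'$ is a $G$--$(v,k',k'-w)$ difference set of $X$.
   Context: A $G$-set is a set $X$ with a map $G\times X\to X$, $(\alpha,x)\mapsto \alpha x$, such that $(\alpha\beta)x=\alpha(\beta x)$ and $1_Gx=x$. For $C\subseteq X$ and $\alpha\in G$, $\alpha C=\{\alpha x: x\in C\}$. A subset $D$ of $X$ with $|D|=k$ is a $G$--$(v,k,\ell)$ difference set of $X$ (where $v=|X|$) if for every $\alpha\in G\setminus\{1_G\}$ there are exactly $\ell$ pairs $(x_1,x_2)\in D\times D$ with $\alpha x_1=x_2$ (equivalently $|\alpha D\cap D|=\ell$). -}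

module Defs where

open import Level using (Level)
open import Data.Nat using (ℕ; _∸_)
open import Data.Fin using (Fin)
open import Data.Fin.Properties using (any?; _≟_)
open import Data.Fin.Subset using (Subset; _∈_; _∩_; ∁; ∣_∣)
open import Data.Fin.Subset.Properties using (_∈?_)
open import Data.Vec using (tabulate)
open import Data.Product using (Σ; ∃; _×_; _,_)
open import Relation.Nullary using (¬_; does)
open import Relation.Nullary.Decidable using (_×-dec_)
open import Relation.Binary.PropositionalEquality using (_≡_)
open import Algebra.Bundles using (Group)

IsFiniteGroup : ∀ {c ℓ} → Group c ℓ → Set (c Level.⊔ ℓ)
IsFiniteGroup G = Σ ℕ λ m → Σ (Fin m → Carrier) λ e → ∀ g → ∃ λ i → e i ≈ g
  where open Group G

record GAction {c ℓ} (G : Group c ℓ) (v : ℕ) : Set (c Level.⊔ ℓ) where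
  open Group G
  field
    act      : Carrier → Fin v → Fin v
    act-cong : ∀ {α β} → α ≈ β → ∀ x → act α x ≡ act β x
    act-∙    : ∀ α β x → act (α ∙ β) x ≡ act α (act β x)
    act-ε    : ∀ x → act ε x ≡ x

image : ∀ {v} → (Fin v → Fin v) → Subset v → Subset v
image {v} f C = tabulate λ y → does (any? (λ x → (x ∈? C) ×-dec (f x ≟ y)))

IsDifferenceSet : ∀ {c ℓ} (G : Group c ℓ) {v : ℕ} → GAction G v →
                  (k l : ℕ) → Subset v → Set (c Level.⊔ ℓ)
IsDifferenceSet G {v} A k l D =
  (∣ D ∣ ≡ k) × (∀ α → ¬ (α ≈ ε) → ∣ image (act α) D ∩ D ∣ ≡ l)
  where open Group G
        open GAction A

-- Every α acts as a permutation of X, so αD is again a k-set and αD' = X ∖ αD.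
-- Splitting αD along D and D' along αD gives, for every α,
--   |αD ∩ D| + |αD ∩ D'| = k   and   |αD ∩ D'| + |αD' ∩ D'| = k',
-- so each of |αD ∩ D| = k − w and |αD' ∩ D'| = k' − w is equivalent to
-- |αD ∩ D'| = w, the subtractions being invertible because w ≤ k and w ≤ k'.
module Submission where

open import Defs
open import Data.Nat using (ℕ; _∸_; _≤_; _+_; suc)
open import Data.Nat.Properties using (m+n∸m≡n; m∸[m∸n]≡n; +-comm; +-suc; +-0-commutativeMonoid)
open import Data.Bool using (Bool; true; false; not)
open import Data.Fin.Properties using (any?; _≟_)
open import Data.Fin.Subset using (Subset; _∩_; ∁; ∣_∣)
open import Data.Fin.Subset.Properties using (_∈?_; ∣∁p∣≡n∸∣p∣; ∩-comm)
open import Data.Fin.Permutation using (Permutation; Permutation′; permutation; flip; _⟨$⟩ʳ_; _⟨$⟩ˡ_)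
import Data.Fin.Permutation as Perm
open import Data.Vec using ([]; _∷_; lookup; tabulate; map)
open import Data.Vec.Properties using (lookup∘tabulate; []=⇒lookup; lookup⇒[]=; lookup-map; tabulate-cong; tabulate-∘)
open import Data.Product using (_×_; _,_)
open import Data.Empty using (⊥-elim)
open import Function using (_∘_)
open import Relation.Nullary using (¬_; does; yes; no)
open import Relation.Nullary.Decidable using (_×-dec_)
open import Relation.Binary.PropositionalEquality
open import Algebra.Bundles using (Group)
open import Algebra.Properties.CommutativeMonoid.Sum +-0-commutativeMonoid using (sum; ∑-permute; sum-cong-≗)

private
  variable
    m n : ℕ

m+n≡o⇒n≡o∸m : ∀ {m n o} → m + n ≡ o → n ≡ o ∸ m
m+n≡o⇒n≡o∸m {m} {n} refl = sym (m+n∸m≡n m n)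

m+n≡o⇒m≡o∸n : ∀ {m n o} → m + n ≡ o → m ≡ o ∸ n
m+n≡o⇒m≡o∸n {m} {n} eq = m+n≡o⇒n≡o∸m (trans (+-comm n m) eq)

indicator : Bool → ℕ
indicator true  = 1
indicator false = 0

∣p∣≡∑indicator : (p : Subset n) → ∣ p ∣ ≡ sum (indicator ∘ lookup p)
∣p∣≡∑indicator []          = refl
∣p∣≡∑indicator (true  ∷ p) = cong suc (∣p∣≡∑indicator p)
∣p∣≡∑indicator (false ∷ p) = ∣p∣≡∑indicator p

∣p∩q∣+∣p∩∁q∣≡∣p∣ : (p q : Subset n) → ∣ p ∩ q ∣ + ∣ p ∩ ∁ q ∣ ≡ ∣ p ∣
∣p∩q∣+∣p∩∁q∣≡∣p∣ []          []          = refl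
∣p∩q∣+∣p∩∁q∣≡∣p∣ (true  ∷ p) (true  ∷ q) = cong suc (∣p∩q∣+∣p∩∁q∣≡∣p∣ p q)
∣p∩q∣+∣p∩∁q∣≡∣p∣ (true  ∷ p) (false ∷ q) =
  trans (+-suc ∣ p ∩ q ∣ ∣ p ∩ ∁ q ∣) (cong suc (∣p∩q∣+∣p∩∁q∣≡∣p∣ p q))
∣p∩q∣+∣p∩∁q∣≡∣p∣ (false ∷ p) (_     ∷ q) = ∣p∩q∣+∣p∩∁q∣≡∣p∣ p q

∣p∘π∣≡∣p∣ : (p : Subset n) (π : Permutation m n) → ∣ tabulate (lookup p ∘ (π ⟨$⟩ʳ_)) ∣ ≡ ∣ p ∣
∣p∘π∣≡∣p∣ {m = m} p π = begin
  ∣ p∘π ∣                                ≡⟨ ∣p∣≡∑indicator p∘π ⟩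
  sum (indicator ∘ lookup p∘π)           ≡⟨ sum-cong-≗ {m} (cong indicator ∘ lookup∘tabulate _) ⟩
  sum (indicator ∘ lookup p ∘ (π ⟨$⟩ʳ_)) ≡⟨ ∑-permute (indicator ∘ lookup p) π ⟨
  sum (indicator ∘ lookup p)             ≡⟨ ∣p∣≡∑indicator p ⟨
  ∣ p ∣                                  ∎
  where
  open ≡-Reasoning
  p∘π = tabulate (lookup p ∘ (π ⟨$⟩ʳ_))

module _ (π : Permutation′ n) where

  image≡p∘π⁻¹ : (p : Subset n) → image (π ⟨$⟩ʳ_) p ≡ tabulate (lookup p ∘ (π ⟨$⟩ˡ_))
  image≡p∘π⁻¹ p = tabulate-cong member
    where
    member : ∀ y → does (any? (λ x → (x ∈? p) ×-dec (π ⟨$⟩ʳ x ≟ y))) ≡ lookup p (π ⟨$⟩ˡ y)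
    member y with any? (λ x → (x ∈? p) ×-dec (π ⟨$⟩ʳ x ≟ y))
    ... | yes (x , x∈p , πx≡y) = sym (subst (λ z → lookup p z ≡ true)
                                            (trans (sym (Perm.inverseˡ π)) (cong (π ⟨$⟩ˡ_) πx≡y))
                                            ([]=⇒lookup x∈p))
    ... | no ∄x with lookup p (π ⟨$⟩ˡ y) in eq
    ...   | false = refl
    ...   | true  = ⊥-elim (∄x (π ⟨$⟩ˡ y , lookup⇒[]= _ p eq , Perm.inverseʳ π))

  ∣image∣≡∣p∣ : (p : Subset n) → ∣ image (π ⟨$⟩ʳ_) p ∣ ≡ ∣ p ∣
  ∣image∣≡∣p∣ p = trans (cong ∣_∣ (image≡p∘π⁻¹ p)) (∣p∘π∣≡∣p∣ p (flip π))

  image-∁ : (p : Subset n) → image (π ⟨$⟩ʳ_) (∁ p) ≡ ∁ (image (π ⟨$⟩ʳ_) p)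
  image-∁ p = begin
    image (π ⟨$⟩ʳ_) (∁ p)                     ≡⟨ image≡p∘π⁻¹ (∁ p) ⟩
    tabulate (lookup (∁ p) ∘ (π ⟨$⟩ˡ_))       ≡⟨ tabulate-cong (λ y → lookup-map (π ⟨$⟩ˡ y) not p) ⟩
    tabulate (not ∘ lookup p ∘ (π ⟨$⟩ˡ_))     ≡⟨ tabulate-∘ not (lookup p ∘ (π ⟨$⟩ˡ_)) ⟩
    map not (tabulate (lookup p ∘ (π ⟨$⟩ˡ_))) ≡⟨ cong (map not) (image≡p∘π⁻¹ p) ⟨
    ∁ (image (π ⟨$⟩ʳ_) p)                     ∎
    where open ≡-Reasoning

  ∣πp∩p∣+∣πp∩∁p∣≡∣p∣ : (p : Subset n) → ∣ image (π ⟨$⟩ʳ_) p ∩ p ∣ + ∣ image (π ⟨$⟩ʳ_) p ∩ ∁ p ∣ ≡ ∣ p ∣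
  ∣πp∩p∣+∣πp∩∁p∣≡∣p∣ p = trans (∣p∩q∣+∣p∩∁q∣≡∣p∣ (image (π ⟨$⟩ʳ_) p) p) (∣image∣≡∣p∣ p)

  ∣πp∩∁p∣+∣π∁p∩∁p∣≡∣∁p∣ : (p : Subset n) →
    ∣ image (π ⟨$⟩ʳ_) p ∩ ∁ p ∣ + ∣ image (π ⟨$⟩ʳ_) (∁ p) ∩ ∁ p ∣ ≡ ∣ ∁ p ∣
  ∣πp∩∁p∣+∣π∁p∩∁p∣≡∣∁p∣ p = begin
    ∣ πp ∩ ∁ p ∣ + ∣ image (π ⟨$⟩ʳ_) (∁ p) ∩ ∁ p ∣ ≡⟨ cong (λ q → ∣ πp ∩ ∁ p ∣ + ∣ q ∩ ∁ p ∣) (image-∁ p) ⟩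
    ∣ πp ∩ ∁ p ∣ + ∣ ∁ πp ∩ ∁ p ∣                 ≡⟨ cong₂ (λ q r → ∣ q ∣ + ∣ r ∣) (∩-comm πp (∁ p)) (∩-comm (∁ πp) (∁ p)) ⟩
    ∣ ∁ p ∩ πp ∣ + ∣ ∁ p ∩ ∁ πp ∣                 ≡⟨ ∣p∩q∣+∣p∩∁q∣≡∣p∣ (∁ p) πp ⟩
    ∣ ∁ p ∣                                       ∎
    where
    open ≡-Reasoning
    πp = image (π ⟨$⟩ʳ_) p

module _ {c ℓ} {G : Group c ℓ} {v : ℕ} (A : GAction G v) where
  open Group G using (Carrier; _⁻¹; inverseˡ; inverseʳ)
  open GAction A

  actPermutation : Carrier → Permutation′ v
  actPermutation α = permutation (act α) (act (α ⁻¹)) cancelʳ cancelˡ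
    where
    cancelʳ : ∀ x → act α (act (α ⁻¹) x) ≡ x
    cancelʳ x = trans (sym (act-∙ α (α ⁻¹) x)) (trans (act-cong (inverseʳ α) x) (act-ε x))
    cancelˡ : ∀ x → act (α ⁻¹) (act α x) ≡ x
    cancelˡ x = trans (sym (act-∙ (α ⁻¹) α x)) (trans (act-cong (inverseˡ α) x) (act-ε x))

lemma2p3 : ∀ {c ℓ} (G : Group c ℓ) → IsFiniteGroup G → (v : ℕ) → (A : GAction G v) → (D : Subset v) → (k w : ℕ) → ∣ D ∣ ≡ k → w ≤ k → w ≤ v ∸ k →
    let open Group G
        open GAction A
        D' = ∁ D
        k' = v ∸ k
        cI = ∀ α → ¬ (α ≈ ε) → ∣ image (act α) D ∩ D' ∣ ≡ w
        cII = IsDifferenceSet G A k (k ∸ w) D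
        cIII = IsDifferenceSet G A k' (k' ∸ w) D'
    in ((cI → cII) × (cII → cIII)) × ((cIII → cI) × (cII → cI))
lemma2p3 G _ v A D k w ∣D∣≡k w≤k w≤k' = ((I⇒II , I⇒III ∘ II⇒I) , (III⇒I , II⇒I))
  where
  open Group G using (_≈_; ε)
  open GAction A
  ∣D'∣≡k' : ∣ ∁ D ∣ ≡ v ∸ k
  ∣D'∣≡k' = trans (∣∁p∣≡n∸∣p∣ D) (cong (v ∸_) ∣D∣≡k)
  split-αD : ∀ α → ∣ image (act α) D ∩ D ∣ + ∣ image (act α) D ∩ ∁ D ∣ ≡ k
  split-αD α = trans (∣πp∩p∣+∣πp∩∁p∣≡∣p∣ (actPermutation A α) D) ∣D∣≡k
  split-D' : ∀ α → ∣ image (act α) D ∩ ∁ D ∣ + ∣ image (act α) (∁ D) ∩ ∁ D ∣ ≡ v ∸ k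
  split-D' α = trans (∣πp∩∁p∣+∣π∁p∩∁p∣≡∣∁p∣ (actPermutation A α) D) ∣D'∣≡k'
  CI = ∀ α → ¬ (α ≈ ε) → ∣ image (act α) D ∩ ∁ D ∣ ≡ w
  I⇒II : CI → IsDifferenceSet G A k (k ∸ w) D
  I⇒II h = ∣D∣≡k , λ α α≉ε → trans (m+n≡o⇒m≡o∸n (split-αD α)) (cong (k ∸_) (h α α≉ε))
  II⇒I : IsDifferenceSet G A k (k ∸ w) D → CI
  II⇒I (_ , h) α α≉ε = trans (m+n≡o⇒n≡o∸m (split-αD α)) (trans (cong (k ∸_) (h α α≉ε)) (m∸[m∸n]≡n w≤k))
  I⇒III : CI → IsDifferenceSet G A (v ∸ k) (v ∸ k ∸ w) (∁ D)
  I⇒III h = ∣D'∣≡k' , λ α α≉ε → trans (m+n≡o⇒n≡o∸m (split-D' α)) (cong (v ∸ k ∸_) (h α α≉ε))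
  III⇒I : IsDifferenceSet G A (v ∸ k) (v ∸ k ∸ w) (∁ D) → CI
  III⇒I (_ , h) α α≉ε = trans (m+n≡o⇒m≡o∸n (split-D' α)) (trans (cong (v ∸ k ∸_) (h α α≉ε)) (m∸[m∸n]≡n w≤k'))
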